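{- $\mathbf{Six}$ is a Logic of Formal Inconsistency (LFI) with respect to $\neg$ with consistency operator $\circ$ defined by $\circ\alpha=\Delta\alpha\vee\Delta\neg\alpha$. That is: (i) there are formulas $\alpha,\beta$ with $\alpha,\neg\alpha\not\models_{\mathbf{Six}}\beta$; (ii) there are formulas $\alpha,\beta$ with $\circ\alpha,\alpha\not\models_{\mathbf{Six}}\beta$ and $\circ\alpha,\neg\alpha\not\models_{\mathbf{Six}}\beta$; (iii) for all formulas $\alpha,\beta$, $\circ\alpha,\alpha,\neg\alpha\models_{\mathbf{Six}}\beta$.
   Context: An involutive Stone algebra is a De Morgan algebra (bounded distributive lattice with $\neg\neg x=x$, $\neg(x\wedge y)=\neg x\vee\neg y$) with a unary $\nabla$ satisfying $\nabla0=0$, $a\wedge\nabla a=a$, $\nabla(a\wedge b)=\nabla a\wedge\nabla b$, $\neg\nabla a\wedge\nabla a=0$; the class is $\mathbf S$. $Fm$ is the set of formulas over a denumerable set of propositional variables built from binary $\wedge,\vee$, unary $\neg,\nabla$ and constants $\bot,\top$; homomorphisms send $\bot\mapsto0,\top\mapsto1$. $\Delta\alpha$ abbreviates $\neg\nabla\neg\alpha$. The logic $\mathbf{Six}$: for nonempty finite premises, $\alpha_1,\dots,\alpha_n\models_{\mathbf{Six}}\alpha$ iff for every $A\in\mathbf S$, every homomorphism $v:\mathfrak{Fm}\to A$ and every $a\in A$, if $v(\alpha_i)\ge a$ for all $i$ then $v(\alpha)\ge a$ (empty premises: $v(\alpha)=1$ for all $A,v$). -}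

module Defs where

open import Data.Nat using (ℕ)
open import Data.List using (List; []; _∷_)
open import Data.List.Relation.Unary.All using (All)
open import Relation.Binary.PropositionalEquality using (_≡_)

-- Involutive Stone algebras: De Morgan algebras (bounded distributive
-- lattices with an involutive De Morgan negation) with an operator ∇.
record ISA : Set₁ where
  infixr 6 _∧_
  infixr 5 _∨_
  field
    Carrier : Set
    _∧_ _∨_ : Carrier → Carrier → Carrier
    ¬_ ∇_   : Carrier → Carrier
    𝟘 𝟙     : Carrier
    ∧-assoc : ∀ x y z → (x ∧ y) ∧ z ≡ x ∧ (y ∧ z)
    ∨-assoc : ∀ x y z → (x ∨ y) ∨ z ≡ x ∨ (y ∨ z)
    ∧-comm  : ∀ x y → x ∧ y ≡ y ∧ x
    ∨-comm  : ∀ x y → x ∨ y ≡ y ∨ x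
    ∧-absorbs-∨ : ∀ x y → x ∧ (x ∨ y) ≡ x
    ∨-absorbs-∧ : ∀ x y → x ∨ (x ∧ y) ≡ x
    ∧-distrib-∨ : ∀ x y z → x ∧ (y ∨ z) ≡ (x ∧ y) ∨ (x ∧ z)
    ∨-identity : ∀ x → x ∨ 𝟘 ≡ x
    ∧-identity : ∀ x → x ∧ 𝟙 ≡ x
    ¬¬-inv  : ∀ x → ¬ (¬ x) ≡ x
    ¬-∧     : ∀ x y → ¬ (x ∧ y) ≡ (¬ x) ∨ (¬ y)
    ∇-𝟘     : ∇ 𝟘 ≡ 𝟘
    ∇-incr  : ∀ a → a ∧ (∇ a) ≡ a
    ∇-∧     : ∀ a b → ∇ (a ∧ b) ≡ (∇ a) ∧ (∇ b)
    ∇-compl : ∀ a → (¬ (∇ a)) ∧ (∇ a) ≡ 𝟘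

  _≤_ : Carrier → Carrier → Set
  a ≤ b = a ∧ b ≡ a

data Fm : Set where
  var : ℕ → Fm
  _∧'_ _∨'_ : Fm → Fm → Fm
  ¬' ∇' : Fm → Fm
  ⊥' ⊤' : Fm

Δ' : Fm → Fm
Δ' α = ¬' (∇' (¬' α))

∘' : Fm → Fm
∘' α = Δ' α ∨' Δ' (¬' α)

eval : (A : ISA) → (ℕ → ISA.Carrier A) → Fm → ISA.Carrier A
eval A v (var n) = v n
eval A v (α ∧' β) = ISA._∧_ A (eval A v α) (eval A v β)
eval A v (α ∨' β) = ISA._∨_ A (eval A v α) (eval A v β)
eval A v (¬' α) = ISA.¬_ A (eval A v α)
eval A v (∇' α) = ISA.∇_ A (eval A v α)
eval A v ⊥' = ISA.𝟘 A
eval A v ⊤' = ISA.𝟙 A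

-- consequence relation of Six (degree-preserving w.r.t. the class S)
_⊨Six_ : List Fm → Fm → Set₁
[] ⊨Six α = ∀ (A : ISA) (v : ℕ → ISA.Carrier A) → eval A v α ≡ ISA.𝟙 A
(γ ∷ Γ) ⊨Six α = ∀ (A : ISA) (v : ℕ → ISA.Carrier A) (a : ISA.Carrier A) →
  All (λ φ → ISA._≤_ A a (eval A v φ)) (γ ∷ Γ) → ISA._≤_ A a (eval A v α)

-- In any involutive Stone algebra, a ≤ x implies a ≤ ∇x, and ∇x is disjoint from
-- ¬∇x; so a lower bound of x and ¬x is disjoint from both disjuncts
-- ¬∇¬x and ¬∇¬¬x of ∘x, and a lower bound of all three is 𝟘. The negative
-- parts are witnessed in the three-element chain 0 < ½ < 1 with ¬½ = ½ and
-- ∇½ = 1: at degree ½ the atom p and ¬p hold while an atom valued 0 fails,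
-- and ∘ is 1 on the classical values 0 and 1.
module Submission where

open import Defs
open import Data.Nat using (ℕ)
open import Data.List using ([]; _∷_)
open import Data.List.Relation.Unary.All using ([]; _∷_)
open import Data.Product using (_×_; ∃₂; _,_)
open import Relation.Nullary using (¬_)
open import Relation.Binary.PropositionalEquality
  using (_≡_; refl; sym; cong; cong₂; module ≡-Reasoning)

module ISA-Properties (A : ISA) where
  open ISA A hiding (¬_)
  open ISA A using () renaming (¬_ to ~_)
  open ≡-Reasoning

  ∘_ : Carrier → Carrier
  ∘ x = ~ ∇ ~ x ∨ ~ ∇ ~ ~ x

  ≤-trans : ∀ {a b c} → a ≤ b → b ≤ c → a ≤ c
  ≤-trans {a} {b} {c} a≤b b≤c = begin
    a ∧ c        ≡⟨ cong (_∧ c) (sym a≤b) ⟩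
    (a ∧ b) ∧ c  ≡⟨ ∧-assoc a b c ⟩
    a ∧ (b ∧ c)  ≡⟨ cong (a ∧_) b≤c ⟩
    a ∧ b        ≡⟨ a≤b ⟩
    a            ∎

  ∧-zeroˡ : ∀ a → 𝟘 ∧ a ≡ 𝟘
  ∧-zeroˡ a = begin
    𝟘 ∧ a        ≡⟨ cong (𝟘 ∧_) (sym (∨-identity a)) ⟩
    𝟘 ∧ (a ∨ 𝟘)  ≡⟨ cong (𝟘 ∧_) (∨-comm a 𝟘) ⟩
    𝟘 ∧ (𝟘 ∨ a)  ≡⟨ ∧-absorbs-∨ 𝟘 a ⟩
    𝟘            ∎

  𝟘-minimum : ∀ a → 𝟘 ≤ a
  𝟘-minimum = ∧-zeroˡ

  ≤⇒≤∇ : ∀ {a x} → a ≤ x → a ≤ (∇ x)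
  ≤⇒≤∇ {x = x} a≤x = ≤-trans a≤x (∇-incr x)

  ≤∇⇒∧¬∇≡𝟘 : ∀ {a x} → a ≤ (∇ x) → a ∧ ~ ∇ x ≡ 𝟘
  ≤∇⇒∧¬∇≡𝟘 {a} {x} a≤∇x = begin
    a ∧ ~ ∇ x            ≡⟨ cong (_∧ ~ ∇ x) (sym a≤∇x) ⟩
    (a ∧ ∇ x) ∧ ~ ∇ x    ≡⟨ ∧-assoc a (∇ x) (~ ∇ x) ⟩
    a ∧ (∇ x ∧ ~ ∇ x)    ≡⟨ cong (a ∧_) (∧-comm (∇ x) (~ ∇ x)) ⟩
    a ∧ (~ ∇ x ∧ ∇ x)    ≡⟨ cong (a ∧_) (∇-compl x) ⟩
    a ∧ 𝟘                ≡⟨ ∧-comm a 𝟘 ⟩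
    𝟘 ∧ a                ≡⟨ ∧-zeroˡ a ⟩
    𝟘                    ∎

  ≤-consistent-contradiction⇒≡𝟘 : ∀ {a x} →
    a ≤ (∘ x) → a ≤ x → a ≤ (~ x) → a ≡ 𝟘
  ≤-consistent-contradiction⇒≡𝟘 {a} {x} a≤∘x a≤x a≤¬x = begin
    a                                  ≡⟨ sym a≤∘x ⟩
    a ∧ (∘ x)                          ≡⟨ ∧-distrib-∨ a _ _ ⟩
    a ∧ ~ ∇ ~ x ∨ a ∧ ~ ∇ ~ ~ x        ≡⟨ cong (λ y → a ∧ ~ ∇ ~ x ∨ a ∧ ~ ∇ y) (¬¬-inv x) ⟩
    a ∧ ~ ∇ ~ x ∨ a ∧ ~ ∇ x            ≡⟨ cong₂ _∨_ (≤∇⇒∧¬∇≡𝟘 (≤⇒≤∇ a≤¬x)) (≤∇⇒∧¬∇≡𝟘 (≤⇒≤∇ a≤x)) ⟩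
    𝟘 ∨ 𝟘                              ≡⟨ ∨-identity 𝟘 ⟩
    𝟘                                  ∎

  ≤-consistent-contradiction⇒≤ : ∀ {a x} →
    a ≤ (∘ x) → a ≤ x → a ≤ (~ x) → ∀ e → a ≤ e
  ≤-consistent-contradiction⇒≤ a≤∘x a≤x a≤¬x e
    rewrite ≤-consistent-contradiction⇒≡𝟘 a≤∘x a≤x a≤¬x = 𝟘-minimum e

data Three : Set where
  0₃ ½₃ 1₃ : Three

infixr 6 _⊓_
infixr 5 _⊔_

_⊓_ : Three → Three → Three
0₃ ⊓ _  = 0₃
½₃ ⊓ 0₃ = 0₃
½₃ ⊓ _  = ½₃
1₃ ⊓ y  = y

_⊔_ : Three → Three → Three
0₃ ⊔ y  = y
½₃ ⊔ 1₃ = 1₃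
½₃ ⊔ _  = ½₃
1₃ ⊔ _  = 1₃

∼₃_ : Three → Three
∼₃ 0₃ = 1₃
∼₃ ½₃ = ½₃
∼₃ 1₃ = 0₃

∇₃ : Three → Three
∇₃ 0₃ = 0₃
∇₃ _  = 1₃

Three-ISA : ISA
Three-ISA = record
  { Carrier = Three ; _∧_ = _⊓_ ; _∨_ = _⊔_ ; ¬_ = ∼₃_ ; ∇_ = ∇₃ ; 𝟘 = 0₃ ; 𝟙 = 1₃
  ; ∧-assoc = ⊓-assoc ; ∨-assoc = ⊔-assoc ; ∧-comm = ⊓-comm ; ∨-comm = ⊔-comm
  ; ∧-absorbs-∨ = ⊓-absorbs-⊔ ; ∨-absorbs-∧ = ⊔-absorbs-⊓ ; ∧-distrib-∨ = ⊓-distrib-⊔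
  ; ∨-identity = ⊔-identityʳ ; ∧-identity = ⊓-identityʳ ; ¬¬-inv = ∼₃-involutive ; ¬-∧ = ∼₃-⊓
  ; ∇-𝟘 = refl ; ∇-incr = ⊓-∇₃ ; ∇-∧ = ∇₃-⊓ ; ∇-compl = ∼₃∇₃-⊓-∇₃
  }
  where
  ⊓-assoc : ∀ x y z → (x ⊓ y) ⊓ z ≡ x ⊓ (y ⊓ z)
  ⊓-assoc 0₃ y  z  = refl
  ⊓-assoc 1₃ y  z  = refl
  ⊓-assoc ½₃ 0₃ z  = refl
  ⊓-assoc ½₃ ½₃ 0₃ = refl
  ⊓-assoc ½₃ ½₃ ½₃ = refl
  ⊓-assoc ½₃ ½₃ 1₃ = refl
  ⊓-assoc ½₃ 1₃ z  = refl

  ⊔-assoc : ∀ x y z → (x ⊔ y) ⊔ z ≡ x ⊔ (y ⊔ z)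
  ⊔-assoc 0₃ y  z  = refl
  ⊔-assoc 1₃ y  z  = refl
  ⊔-assoc ½₃ 0₃ z  = refl
  ⊔-assoc ½₃ ½₃ 0₃ = refl
  ⊔-assoc ½₃ ½₃ ½₃ = refl
  ⊔-assoc ½₃ ½₃ 1₃ = refl
  ⊔-assoc ½₃ 1₃ z  = refl

  ⊓-comm : ∀ x y → x ⊓ y ≡ y ⊓ x
  ⊓-comm 0₃ 0₃ = refl
  ⊓-comm 0₃ ½₃ = refl
  ⊓-comm 0₃ 1₃ = refl
  ⊓-comm ½₃ 0₃ = refl
  ⊓-comm ½₃ ½₃ = refl
  ⊓-comm ½₃ 1₃ = refl
  ⊓-comm 1₃ 0₃ = refl
  ⊓-comm 1₃ ½₃ = refl
  ⊓-comm 1₃ 1₃ = refl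

  ⊔-comm : ∀ x y → x ⊔ y ≡ y ⊔ x
  ⊔-comm 0₃ 0₃ = refl
  ⊔-comm 0₃ ½₃ = refl
  ⊔-comm 0₃ 1₃ = refl
  ⊔-comm ½₃ 0₃ = refl
  ⊔-comm ½₃ ½₃ = refl
  ⊔-comm ½₃ 1₃ = refl
  ⊔-comm 1₃ 0₃ = refl
  ⊔-comm 1₃ ½₃ = refl
  ⊔-comm 1₃ 1₃ = refl

  ⊓-absorbs-⊔ : ∀ x y → x ⊓ (x ⊔ y) ≡ x
  ⊓-absorbs-⊔ 0₃ y  = refl
  ⊓-absorbs-⊔ ½₃ 0₃ = refl
  ⊓-absorbs-⊔ ½₃ ½₃ = refl
  ⊓-absorbs-⊔ ½₃ 1₃ = refl
  ⊓-absorbs-⊔ 1₃ y  = refl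

  ⊔-absorbs-⊓ : ∀ x y → x ⊔ (x ⊓ y) ≡ x
  ⊔-absorbs-⊓ 0₃ y  = refl
  ⊔-absorbs-⊓ ½₃ 0₃ = refl
  ⊔-absorbs-⊓ ½₃ ½₃ = refl
  ⊔-absorbs-⊓ ½₃ 1₃ = refl
  ⊔-absorbs-⊓ 1₃ y  = refl

  ⊓-distrib-⊔ : ∀ x y z → x ⊓ (y ⊔ z) ≡ (x ⊓ y) ⊔ (x ⊓ z)
  ⊓-distrib-⊔ 0₃ y  z  = refl
  ⊓-distrib-⊔ 1₃ y  z  = refl
  ⊓-distrib-⊔ ½₃ 0₃ z  = refl
  ⊓-distrib-⊔ ½₃ ½₃ 0₃ = refl
  ⊓-distrib-⊔ ½₃ ½₃ ½₃ = refl
  ⊓-distrib-⊔ ½₃ ½₃ 1₃ = refl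
  ⊓-distrib-⊔ ½₃ 1₃ 0₃ = refl
  ⊓-distrib-⊔ ½₃ 1₃ ½₃ = refl
  ⊓-distrib-⊔ ½₃ 1₃ 1₃ = refl

  ⊔-identityʳ : ∀ x → x ⊔ 0₃ ≡ x
  ⊔-identityʳ 0₃ = refl
  ⊔-identityʳ ½₃ = refl
  ⊔-identityʳ 1₃ = refl

  ⊓-identityʳ : ∀ x → x ⊓ 1₃ ≡ x
  ⊓-identityʳ 0₃ = refl
  ⊓-identityʳ ½₃ = refl
  ⊓-identityʳ 1₃ = refl

  ∼₃-involutive : ∀ x → ∼₃ ∼₃ x ≡ x
  ∼₃-involutive 0₃ = refl
  ∼₃-involutive ½₃ = refl
  ∼₃-involutive 1₃ = refl

  ∼₃-⊓ : ∀ x y → ∼₃ (x ⊓ y) ≡ ∼₃ x ⊔ ∼₃ y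
  ∼₃-⊓ 0₃ y  = refl
  ∼₃-⊓ 1₃ y  = refl
  ∼₃-⊓ ½₃ 0₃ = refl
  ∼₃-⊓ ½₃ ½₃ = refl
  ∼₃-⊓ ½₃ 1₃ = refl

  ⊓-∇₃ : ∀ x → x ⊓ ∇₃ x ≡ x
  ⊓-∇₃ 0₃ = refl
  ⊓-∇₃ ½₃ = refl
  ⊓-∇₃ 1₃ = refl

  ∇₃-⊓ : ∀ x y → ∇₃ (x ⊓ y) ≡ ∇₃ x ⊓ ∇₃ y
  ∇₃-⊓ 0₃ y  = refl
  ∇₃-⊓ 1₃ y  = refl
  ∇₃-⊓ ½₃ 0₃ = refl
  ∇₃-⊓ ½₃ ½₃ = refl
  ∇₃-⊓ ½₃ 1₃ = refl

  ∼₃∇₃-⊓-∇₃ : ∀ x → ∼₃ ∇₃ x ⊓ ∇₃ x ≡ 0₃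
  ∼₃∇₃-⊓-∇₃ 0₃ = refl
  ∼₃∇₃-⊓-∇₃ ½₃ = refl
  ∼₃∇₃-⊓-∇₃ 1₃ = refl

p q : Fm
p = var 0
q = var 1

p↦_ : Three → ℕ → Three
(p↦ x) 0 = x
(p↦ x) _ = 0₃

0₃≢½₃ : ¬ (0₃ ≡ ½₃)
0₃≢½₃ ()

0₃≢1₃ : ¬ (0₃ ≡ 1₃)
0₃≢1₃ ()

mainTheorem5 : (∃₂ λ α β → ¬ ((α ∷ ¬' α ∷ []) ⊨Six β))
    × (∃₂ λ α β → ¬ ((∘' α ∷ α ∷ []) ⊨Six β) × ¬ ((∘' α ∷ ¬' α ∷ []) ⊨Six β))
    × (∀ α β → (∘' α ∷ α ∷ ¬' α ∷ []) ⊨Six β)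
mainTheorem5 =
    (p , q , λ p,¬p⊨q → 0₃≢½₃ (p,¬p⊨q Three-ISA (p↦ ½₃) ½₃ (refl ∷ refl ∷ [])))
  , (p , q , (λ ∘p,p⊨q → 0₃≢1₃ (∘p,p⊨q Three-ISA (p↦ 1₃) 1₃ (refl ∷ refl ∷ [])))
           , (λ ∘p,¬p⊨q → 0₃≢1₃ (∘p,¬p⊨q Three-ISA (p↦ 0₃) 1₃ (refl ∷ refl ∷ []))))
  , λ { α β A v a (a≤∘α ∷ a≤α ∷ a≤¬α ∷ []) →
          ISA-Properties.≤-consistent-contradiction⇒≤ A a≤∘α a≤α a≤¬α (eval A v β) }
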